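{- Let $\mathcal{A}=\left(\frac{ -a,-b}{\mathbb{Q}}\right)$ be a rational quaternion division algebra with $a,b>0$, let $H$ be an order in $\mathcal{A}$, and let $\rho_1,\rho_2\in\mathcal{A}\setminus H$ with $\rho_1-\rho_2\in H$. Then $\rho_1\in\mathcal{S}_H$ if and only if $\rho_2\in\mathcal{S}_H$.
   Context: $\mathcal{A}$ has $\mathbb{Q}$-basis $1,i,j,k$ with $i^2=-a$, $j^2=-b$, $k=ij=-ji$, and norm $\mathrm{N}(x_0+x_1i+x_2j+x_3k)=x_0^2+ax_1^2+bx_2^2+abx_3^2$. An order is a subring containing $1$ that is a finitely generated $\mathbb{Z}$-module spanning $\mathcal{A}$ over $\mathbb{Q}$. Define $\mathcal{D}_{\mathcal{A}}=\{\rho\in\mathcal{A}: 0<\mathrm{N}(\rho)<1\}$ and $\mathcal{S}_H=\{\rho\in\mathcal{A}\setminus H:\ \exists\,\alpha,\beta\in H,\ \alpha\rho-\beta\in\mathcal{D}_{\mathcal{A}}\}$. -}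

module Defs where

open import Data.Nat using (ℕ; zero; suc)
open import Data.Integer using (ℤ)
open import Data.Rational using (ℚ; _+_; _*_; -_; _-_; _<_; 0ℚ; 1ℚ; _/_)
open import Data.Fin using (Fin; zero; suc)
open import Data.Product using (Σ; _×_; ∃; ∃-syntax; _,_)
open import Relation.Binary.PropositionalEquality using (_≡_; _≢_)
open import Relation.Nullary using (¬_)

-- Elements of the quaternion algebra (-a,-b / ℚ), written in the
-- ℚ-basis 1, i, j, k as x0 + x1 i + x2 j + x3 k.
record Quat : Set where
  constructor quat
  field
    x0 x1 x2 x3 : ℚ
open Quat public

infixl 6 _⊕_ _⊖_
infixl 7 _·_

_⊕_ : Quat → Quat → Quat
quat x0 x1 x2 x3 ⊕ quat y0 y1 y2 y3 = quat (x0 + y0) (x1 + y1) (x2 + y2) (x3 + y3)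

⊝_ : Quat → Quat
⊝ quat x0 x1 x2 x3 = quat (- x0) (- x1) (- x2) (- x3)

_⊖_ : Quat → Quat → Quat
x ⊖ y = x ⊕ (⊝ y)

_·_ : ℚ → Quat → Quat
c · quat x0 x1 x2 x3 = quat (c * x0) (c * x1) (c * x2) (c * x3)

0Q 1Q : Quat
0Q = quat 0ℚ 0ℚ 0ℚ 0ℚ
1Q = quat 1ℚ 0ℚ 0ℚ 0ℚ

-- Multiplication in (-a,-b / ℚ): i² = -a, j² = -b, k = ij = -ji
-- (hence k² = -ab, jk = b i, kj = -b i, ki = a j, ik = -a j).
mulQ : ℚ → ℚ → Quat → Quat → Quat
mulQ a b (quat x0 x1 x2 x3) (quat y0 y1 y2 y3) =
  quat (x0 * y0 - a * (x1 * y1) - b * (x2 * y2) - (a * b) * (x3 * y3))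
       (x0 * y1 + x1 * y0 + b * (x2 * y3) - b * (x3 * y2))
       (x0 * y2 + x2 * y0 - a * (x1 * y3) + a * (x3 * y1))
       (x0 * y3 + x3 * y0 + x1 * y2 - x2 * y1)

normQ : ℚ → ℚ → Quat → ℚ
normQ a b (quat x0 x1 x2 x3) =
  x0 * x0 + a * (x1 * x1) + b * (x2 * x2) + (a * b) * (x3 * x3)

IsDivision : ℚ → ℚ → Set
IsDivision a b = ∀ x → x ≢ 0Q → ∃[ y ] (mulQ a b x y ≡ 1Q × mulQ a b y x ≡ 1Q)

linComb : (n : ℕ) → (Fin n → ℚ) → (Fin n → Quat) → Quat
linComb zero    c v = 0Q
linComb (suc n) c v = (c zero · v zero) ⊕ linComb n (λ t → c (suc t)) (λ t → v (suc t))

ι : ℤ → ℚ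
ι z = z / 1

record IsOrder (a b : ℚ) (H : Quat → Set) : Set where
  field
    one∈   : H 1Q
    +-closed : ∀ {x y} → H x → H y → H (x ⊕ y)
    neg-closed : ∀ {x} → H x → H (⊝ x)
    *-closed : ∀ {x y} → H x → H y → H (mulQ a b x y)
    finGen : ∃[ n ] Σ (Fin n → Quat) λ g →
               (∀ t → H (g t)) ×
               (∀ x → H x → Σ (Fin n → ℤ) λ c → x ≡ linComb n (λ t → ι (c t)) g)
    spans  : ∀ x → ∃[ n ] Σ (Fin n → Quat) λ v → Σ (Fin n → ℚ) λ c →
               (∀ t → H (v t)) × (x ≡ linComb n c v)

InD : ℚ → ℚ → Quat → Set
InD a b ρ = (0ℚ < normQ a b ρ) × (normQ a b ρ < 1ℚ)

InS : ℚ → ℚ → (Quat → Set) → Quat → Set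
InS a b H ρ = ¬ H ρ × ∃[ α ] ∃[ β ] (H α × H β × InD a b (mulQ a b α ρ ⊖ β))

-- Translating ρ by an element δ of H does not change membership in 𝒮_H: if αρ − β ∈ 𝒟_𝒜
-- with α, β ∈ H, then α(ρ − δ) − (β − αδ) is the same element, and β − αδ ∈ H.
module Submission where

open import Defs
open import Data.Product using (_,_)
open import Data.Rational using (ℚ; _<_; 0ℚ; _-_; -_)
open import Data.Rational.Solver using (module +-*-Solver)
open import Function.Bundles using (_⇔_; mk⇔)
open import Relation.Binary.PropositionalEquality using (_≡_; refl; sym; trans; cong; subst)
open import Relation.Nullary using (¬_)

open +-*-Solver

quat-cong : ∀ {x0 x1 x2 x3 y0 y1 y2 y3} →
            x0 ≡ y0 → x1 ≡ y1 → x2 ≡ y2 → x3 ≡ y3 → quat x0 x1 x2 x3 ≡ quat y0 y1 y2 y3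
quat-cong refl refl refl refl = refl

mulQ-distribˡ-⊖ : ∀ a b x y z → mulQ a b x (y ⊖ z) ≡ mulQ a b x y ⊖ mulQ a b x z
mulQ-distribˡ-⊖ a b (quat x0 x1 x2 x3) (quat y0 y1 y2 y3) (quat z0 z1 z2 z3) = quat-cong
  (solve 14 (λ a b x0 x1 x2 x3 y0 y1 y2 y3 z0 z1 z2 z3 →
       x0 :* (y0 :- z0) :- a :* (x1 :* (y1 :- z1)) :- b :* (x2 :* (y2 :- z2)) :- (a :* b) :* (x3 :* (y3 :- z3))
    := (x0 :* y0 :- a :* (x1 :* y1) :- b :* (x2 :* y2) :- (a :* b) :* (x3 :* y3))
    :- (x0 :* z0 :- a :* (x1 :* z1) :- b :* (x2 :* z2) :- (a :* b) :* (x3 :* z3)))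
    refl a b x0 x1 x2 x3 y0 y1 y2 y3 z0 z1 z2 z3)
  (solve 13 (λ b x0 x1 x2 x3 y0 y1 y2 y3 z0 z1 z2 z3 →
       x0 :* (y1 :- z1) :+ x1 :* (y0 :- z0) :+ b :* (x2 :* (y3 :- z3)) :- b :* (x3 :* (y2 :- z2))
    := (x0 :* y1 :+ x1 :* y0 :+ b :* (x2 :* y3) :- b :* (x3 :* y2))
    :- (x0 :* z1 :+ x1 :* z0 :+ b :* (x2 :* z3) :- b :* (x3 :* z2)))
    refl b x0 x1 x2 x3 y0 y1 y2 y3 z0 z1 z2 z3)
  (solve 13 (λ a x0 x1 x2 x3 y0 y1 y2 y3 z0 z1 z2 z3 →
       x0 :* (y2 :- z2) :+ x2 :* (y0 :- z0) :- a :* (x1 :* (y3 :- z3)) :+ a :* (x3 :* (y1 :- z1))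
    := (x0 :* y2 :+ x2 :* y0 :- a :* (x1 :* y3) :+ a :* (x3 :* y1))
    :- (x0 :* z2 :+ x2 :* z0 :- a :* (x1 :* z3) :+ a :* (x3 :* z1)))
    refl a x0 x1 x2 x3 y0 y1 y2 y3 z0 z1 z2 z3)
  (solve 12 (λ x0 x1 x2 x3 y0 y1 y2 y3 z0 z1 z2 z3 →
       x0 :* (y3 :- z3) :+ x3 :* (y0 :- z0) :+ x1 :* (y2 :- z2) :- x2 :* (y1 :- z1)
    := (x0 :* y3 :+ x3 :* y0 :+ x1 :* y2 :- x2 :* y1)
    :- (x0 :* z3 :+ x3 :* z0 :+ x1 :* z2 :- x2 :* z1))
    refl x0 x1 x2 x3 y0 y1 y2 y3 z0 z1 z2 z3)

⊝[x⊖y]≡y⊖x : ∀ x y → ⊝ (x ⊖ y) ≡ y ⊖ x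
⊝[x⊖y]≡y⊖x (quat x0 x1 x2 x3) (quat y0 y1 y2 y3) =
  quat-cong (component x0 y0) (component x1 y1) (component x2 y2) (component x3 y3)
  where
  component : ∀ x y → - (x - y) ≡ y - x
  component = solve 2 (λ x y → :- (x :- y) := y :- x) refl

x⊖[z⊖[y⊖x]]≡y⊖z : ∀ x y z → x ⊖ (z ⊖ (y ⊖ x)) ≡ y ⊖ z
x⊖[z⊖[y⊖x]]≡y⊖z (quat x0 x1 x2 x3) (quat y0 y1 y2 y3) (quat z0 z1 z2 z3) =
  quat-cong (component x0 y0 z0) (component x1 y1 z1) (component x2 y2 z2) (component x3 y3 z3)
  where
  component : ∀ x y z → x - (z - (y - x)) ≡ y - z
  component = solve 3 (λ x y z → x :- (z :- (y :- x)) := y :- z) refl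

module _ {a b : ℚ} {H : Quat → Set} (order : IsOrder a b H) where
  open IsOrder order

  ⊖-closed : ∀ {x y} → H x → H y → H (x ⊖ y)
  ⊖-closed hx hy = +-closed hx (neg-closed hy)

  ⊖-closed-swap : ∀ {x y} → H (x ⊖ y) → H (y ⊖ x)
  ⊖-closed-swap {x} {y} h = subst H (⊝[x⊖y]≡y⊖x x y) (neg-closed h)

  InS-transfer : ∀ {ρ₁ ρ₂} → ¬ H ρ₂ → H (ρ₁ ⊖ ρ₂) → InS a b H ρ₁ → InS a b H ρ₂
  InS-transfer {ρ₁} {ρ₂} ρ₂∉H δ∈H (_ , α , β , α∈H , β∈H , αρ₁-β∈𝒟) =
    ρ₂∉H , α , β ⊖ mulQ a b α (ρ₁ ⊖ ρ₂) , α∈H , ⊖-closed β∈H (*-closed α∈H δ∈H) ,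
    subst (InD a b) (sym same-element) αρ₁-β∈𝒟
    where
    same-element : mulQ a b α ρ₂ ⊖ (β ⊖ mulQ a b α (ρ₁ ⊖ ρ₂)) ≡ mulQ a b α ρ₁ ⊖ β
    same-element = trans
      (cong (λ αδ → mulQ a b α ρ₂ ⊖ (β ⊖ αδ)) (mulQ-distribˡ-⊖ a b α ρ₁ ρ₂))
      (x⊖[z⊖[y⊖x]]≡y⊖z (mulQ a b α ρ₂) (mulQ a b α ρ₁) β)

corollary4p2 : (a b : ℚ) → 0ℚ < a → 0ℚ < b → IsDivision a b →
    (H : Quat → Set) → IsOrder a b H →
    (ρ₁ ρ₂ : Quat) → ¬ H ρ₁ → ¬ H ρ₂ → H (ρ₁ ⊖ ρ₂) →
    InS a b H ρ₁ ⇔ InS a b H ρ₂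
corollary4p2 a b _ _ _ H order ρ₁ ρ₂ ρ₁∉H ρ₂∉H δ∈H =
  mk⇔ (InS-transfer order ρ₂∉H δ∈H)
      (InS-transfer order ρ₁∉H (⊖-closed-swap order {ρ₁} {ρ₂} δ∈H))
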